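{- Let $0\le k\le k+p<n$ be integers and let $A=a_1\cdots a_n$ be a binary string with $a_1=1$ and $w(A)=k+p+1$. Let $A^\infty$ be generated from $A$ by the symmetric shift register with parameters $k,p,n$, and write $V(A^\infty)=(q_1,q_2,\dots)$. If $j$ is the least even vector period of $V(A^\infty)$, then $q_1+\cdots+q_j$ is the minimal period of $A^\infty$.
   Context: $w(A)$ is the number of 1's in $A$. The symmetric shift register with parameters $k,p,n$ generates from $A$ the sequence $A^\infty=a_1a_2\cdots$ by: for $i\ge0$, $a_{n+i+1}=1-a_{i+1}$ if $k\le a_{i+2}+\cdots+a_{i+n}\le k+p$, and $a_{n+i+1}=a_{i+1}$ otherwise. A period of $A^\infty$ is an $r\ge1$ with $a_{r+i}=a_i$ for all $i\ge1$; the minimal period is the least one. $A^\infty$ starts with 1 and contains infinitely many 0's and 1's, so it can be written uniquely as $1_{q_1}0_{q_2}1_{q_3}0_{q_4}\cdots$ with all $q_i\ge1$ ($1_q$, $0_q$ denote $q$ consecutive 1's or 0's), and $V(A^\infty)=(q_1,q_2,\dots)$. An even vector period of $V(A^\infty)$ is an even $j>0$ with $q_{j+i}=q_i$ for all $i\ge1$. -}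

module Defs where

open import Data.Nat using (ℕ; zero; suc; _+_; _≤_; _<_; _≤ᵇ_)
open import Data.Bool using (Bool; true; false; not; if_then_else_; _∧_)
open import Data.Vec using (Vec; []; _∷_; _∷ʳ_)
open import Data.Product using (_×_)
open import Relation.Binary.PropositionalEquality using (_≡_)

weight : ∀ {n} → Vec Bool n → ℕ
weight [] = 0
weight (true ∷ xs) = suc (weight xs)
weight (false ∷ xs) = weight xs

-- first symbol a_1 (the empty string never occurs since k+p<n forces n ≥ 1)
first : ∀ {n} → Vec Bool n → Bool
first [] = false
first (x ∷ _) = x

step : ℕ → ℕ → ∀ {n} → Vec Bool n → Vec Bool n
step k p [] = []
step k p (x ∷ xs) =
  xs ∷ʳ (if (k ≤ᵇ weight xs) ∧ (weight xs ≤ᵇ k + p) then not x else x)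

window : ℕ → ℕ → ∀ {n} → Vec Bool n → ℕ → Vec Bool n
window k p A zero = A
window k p A (suc i) = step k p (window k p A i)

-- the generated sequence, 0-indexed: seqA k p A i = a_{i+1}
seqA : ℕ → ℕ → ∀ {n} → Vec Bool n → ℕ → Bool
seqA k p A i = first (window k p A i)

IsPeriod : (ℕ → Bool) → ℕ → Set
IsPeriod s r = (1 ≤ r) × (∀ i → s (r + i) ≡ s i)

IsMinimalPeriod : (ℕ → Bool) → ℕ → Set
IsMinimalPeriod s r = IsPeriod s r × (∀ r' → IsPeriod s r' → r ≤ r')

-- partial sums: psum q i = q_1 + ... + q_i  (q is 0-indexed: q i = q_{i+1})
psum : (ℕ → ℕ) → ℕ → ℕ
psum q zero = 0
psum q (suc i) = psum q i + q i

isEven : ℕ → Bool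
isEven zero = true
isEven (suc n) = not (isEven n)

-- q = V(s): s = 1_{q_1} 0_{q_2} 1_{q_3} ... with all q_i ≥ 1.
-- Block i (0-indexed) occupies positions psum q i ≤ t < psum q (i+1)
-- and consists of 1's iff i is even.
IsRunVector : (ℕ → Bool) → (ℕ → ℕ) → Set
IsRunVector s q =
  (∀ i → 1 ≤ q i) ×
  (∀ i t → psum q i ≤ t → t < psum q (suc i) → s t ≡ isEven i)

IsEvenVectorPeriod : (ℕ → ℕ) → ℕ → Set
IsEvenVectorPeriod q j = (isEven j ≡ true) × (0 < j) × (∀ i → q (j + i) ≡ q i)

IsLeastEvenVectorPeriod : (ℕ → ℕ) → ℕ → Set
IsLeastEvenVectorPeriod q j =
  IsEvenVectorPeriod q j × (∀ j' → IsEvenVectorPeriod q j' → j ≤ j')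

module Submission where

-- A window of weight k+p+1 can only be produced from a window starting with 0:
-- if the dropped bit is 1, the new bit is 0 exactly when the remaining n-1 bits
-- have weight in [k, k+p], and either way the weight cannot come out as k+p+1.
-- If r is a period of A^∞, the window at position r is A again, of weight k+p+1,
-- so a_r = 0 while a_{r+1} = a_1 = 1 and r is the start of a run of 1's:
-- r = q_1 + ... + q_b with b even.  Shifting A^∞ by r shifts its run vector by b,
-- so b is an even vector period and b ≥ j.  Conversely, shifting the run vector by j leaves it unchanged,
-- so q_1 + ... + q_j is a period.

open import Defs
open import Data.Nat using (ℕ; zero; suc; _+_; _<_; _≤_; _≤ᵇ_; z≤n; s≤s)
open import Data.Nat.Properties
open import Data.Bool using (Bool; true; false; not; _∧_; T)
open import Data.Bool.Properties using (not-¬; T-∧)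
open import Data.Vec using (Vec; []; _∷_; _∷ʳ_)
open import Data.Product using (_×_; _,_; ∃-syntax; proj₁; proj₂)
open import Data.Sum using (inj₁; inj₂)
open import Data.Unit using (tt)
open import Data.Empty using (⊥-elim)
open import Function.Bundles using (Equivalence)
open import Relation.Binary.PropositionalEquality
open import Relation.Nullary using (contradiction)

private
  variable
    s s' : ℕ → Bool
    q q' : ℕ → ℕ

psum-+ : ∀ (q : ℕ → ℕ) b i → psum q (b + i) ≡ psum q b + psum (λ x → q (b + x)) i
psum-+ q b zero = trans (cong (psum q) (+-identityʳ b)) (sym (+-identityʳ _))
psum-+ q b (suc i) = begin
  psum q (b + suc i)                          ≡⟨ cong (psum q) (+-suc b i) ⟩
  psum q (b + i) + q (b + i)                  ≡⟨ cong (_+ q (b + i)) (psum-+ q b i) ⟩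
  psum q b + psum q₊ i + q (b + i)            ≡⟨ +-assoc (psum q b) _ _ ⟩
  psum q b + (psum q₊ i + q (b + i))          ∎
  where
  open ≡-Reasoning
  q₊ : ℕ → ℕ
  q₊ x = q (b + x)

psum-cong : q ≗ q' → psum q ≗ psum q'
psum-cong eq zero = refl
psum-cong eq (suc i) = cong₂ _+_ (psum-cong eq i) (eq i)

psum-mono-≤ : ∀ (q : ℕ → ℕ) {a b} → a ≤ b → psum q a ≤ psum q b
psum-mono-≤ q {a} a≤b with m≤n⇒∃[o]m+o≡n a≤b
... | d , refl = subst (psum q a ≤_) (sym (psum-+ q a d)) (m≤m+n _ _)

psum-positive : (∀ i → 1 ≤ q i) → ∀ {j} → 0 < j → 1 ≤ psum q j
psum-positive {q} pos {suc j} _ = ≤-trans (pos j) (m≤n+m (q j) (psum q j))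

psum<psum-suc : (∀ i → 1 ≤ q i) → ∀ i → psum q i < psum q (suc i)
psum<psum-suc pos i = m<m+n _ (pos i)

psum-cover : (∀ i → 1 ≤ q i) → ∀ t → ∃[ i ] psum q i ≤ t × t < psum q (suc i)
psum-cover pos zero = 0 , z≤n , pos 0
psum-cover {q} pos (suc t) with psum-cover pos t
... | i , lo , hi with m≤n⇒m<n∨m≡n hi
...   | inj₁ t+1<end = i , m≤n⇒m≤1+n lo , t+1<end
...   | inj₂ t+1≡end = suc i , ≤-reflexive (sym t+1≡end)
                     , subst (_< psum q (suc (suc i))) (sym t+1≡end) (psum<psum-suc pos (suc i))

isEven-+ : ∀ j i → isEven j ≡ true → isEven (j + i) ≡ isEven i
isEven-+ j zero ev = trans (cong isEven (+-identityʳ j)) ev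
isEven-+ j (suc i) ev = trans (cong isEven (+-suc j i)) (cong not (isEven-+ j i ev))

runVector-head : IsRunVector s q → ∀ i → s (psum q i) ≡ isEven i
runVector-head (pos , runs) i = runs i _ ≤-refl (psum<psum-suc pos i)

runVector-resp-≗ : s ≗ s' → IsRunVector s q → IsRunVector s' q
runVector-resp-≗ s≗s' (pos , runs) = pos , λ i t lo hi → trans (sym (s≗s' t)) (runs i t lo hi)

runVector-drop : ∀ {b} → IsRunVector s q → isEven b ≡ true →
  IsRunVector (λ t → s (psum q b + t)) (λ i → q (b + i))
runVector-drop {s} {q} {b} (pos , runs) ev = (λ i → pos (b + i)) , λ i t lo hi →
  trans (runs (b + i) (psum q b + t) (start i lo) (end i hi)) (isEven-+ b i ev)
  where
  q₊ : ℕ → ℕ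
  q₊ i = q (b + i)
  start : ∀ i {t} → psum q₊ i ≤ t → psum q (b + i) ≤ psum q b + t
  start i lo = subst (_≤ psum q b + _) (sym (psum-+ q b i)) (+-monoʳ-≤ (psum q b) lo)
  end : ∀ i {t} → t < psum q₊ (suc i) → psum q b + t < psum q (suc (b + i))
  end i {t} hi = subst (psum q b + t <_) (trans (sym (psum-+ q b (suc i))) (cong (psum q) (+-suc b i)))
                   (+-monoʳ-< (psum q b) hi)

runVector-determines : IsRunVector s q → IsRunVector s' q' → q ≗ q' → s ≗ s'
runVector-determines {q = q} R@(pos , runs) (_ , runs') q≗q' t with psum-cover pos t
... | i , lo , hi = trans (runs i t lo hi)
  (sym (runs' i t (subst (_≤ t) (psum-cong q≗q' i) lo) (subst (t <_) (psum-cong q≗q' (suc i)) hi)))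

-- If block i+1 of q' ended first, its last position would lie inside block i of q.
psum-suc-≤ : IsRunVector s q → IsRunVector s q' → ∀ i →
  psum q i ≡ psum q' i → psum q (suc i) ≤ psum q' (suc i)
psum-suc-≤ {q = q} {q' = q'} (_ , runs) R' i eq = ≮⇒≥ λ end'<end →
  not-¬ (runs i (psum q' (suc i)) start end'<end) (runVector-head R' (suc i))
  where
  start : psum q i ≤ psum q' (suc i)
  start = subst (_≤ _) (sym eq) (<⇒≤ (psum<psum-suc (proj₁ R') i))

runVector-psum-unique : IsRunVector s q → IsRunVector s q' → psum q ≗ psum q'
runVector-psum-unique R R' zero = refl
runVector-psum-unique R R' (suc i) =
  ≤-antisym (psum-suc-≤ R R' i eq) (psum-suc-≤ R' R i (sym eq))
  where eq = runVector-psum-unique R R' i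

runVector-unique : IsRunVector s q → IsRunVector s q' → q ≗ q'
runVector-unique {q = q} {q' = q'} R R' i = +-cancelˡ-≡ (psum q i) (q i) (q' i)
  (trans (runVector-psum-unique R R' (suc i)) (cong (_+ q' i) (sym (runVector-psum-unique R R' i))))

runVector-switch : ∀ {m} → IsRunVector s q → s m ≡ false → s (suc m) ≡ true →
  ∃[ b ] psum q b ≡ suc m × isEven b ≡ true
runVector-switch {s} {q} {m} (pos , runs) sm sm+1 with psum-cover pos (suc m)
... | b , lo , hi = b , boundary , even
  where
  even : isEven b ≡ true
  even = trans (sym (runs b (suc m) lo hi)) sm+1
  boundary : psum q b ≡ suc m
  boundary with m≤n⇒m<n∨m≡n lo
  ... | inj₂ start≡m+1 = start≡m+1
  ... | inj₁ (s≤s start≤m) =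
    contradiction (trans (sym sm) (trans (runs b m start≤m (<-trans (n<1+n m) hi)) even)) λ ()

evenVectorPeriod⇒period : ∀ {j} → IsRunVector s q → IsEvenVectorPeriod q j → IsPeriod s (psum q j)
evenVectorPeriod⇒period R@(pos , _) (ev , 0<j , shift) =
  psum-positive pos 0<j , runVector-determines (runVector-drop R ev) R shift

period⇒evenVectorPeriod : ∀ {b} → IsRunVector s q → IsPeriod s (psum q b) → isEven b ≡ true →
  IsEvenVectorPeriod q b
period⇒evenVectorPeriod {b = suc b} R (_ , shift) ev =
  ev , s≤s z≤n , runVector-unique (runVector-drop R ev) (runVector-resp-≗ (λ t → sym (shift t)) R)

leastEvenVectorPeriod⇒minimalPeriod : ∀ {j} → IsRunVector s q → s 0 ≡ true →
  (∀ m → IsPeriod s (suc m) → s m ≡ false) →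
  IsLeastEvenVectorPeriod q j → IsMinimalPeriod s (psum q j)
leastEvenVectorPeriod⇒minimalPeriod {s} {q} {j} R s0 endsIn0 (evp , least) =
  evenVectorPeriod⇒period R evp , minimal
  where
  minimal : ∀ r → IsPeriod s r → psum q j ≤ r
  minimal (suc m) per@(_ , shift)
    with runVector-switch R (endsIn0 m per) (trans (cong s (sym (+-identityʳ (suc m)))) (trans (shift 0) s0))
  ... | b , start≡r , ev =
    ≤-trans (psum-mono-≤ q (least b (period⇒evenVectorPeriod R (subst (IsPeriod s) (sym start≡r) per) ev)))
            (≤-reflexive start≡r)

bit : Bool → ℕ
bit true = 1
bit false = 0

weight-∷ʳ : ∀ {n} (xs : Vec Bool n) y → weight (xs ∷ʳ y) ≡ weight xs + bit y
weight-∷ʳ [] true = refl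
weight-∷ʳ [] false = refl
weight-∷ʳ (true ∷ xs) y = cong suc (weight-∷ʳ xs y)
weight-∷ʳ (false ∷ xs) y = weight-∷ʳ xs y

step-heavy⇒first≡false : ∀ k p {n} (w : Vec Bool (suc n)) →
  weight (step k p w) ≡ suc (k + p) → first w ≡ false
step-heavy⇒first≡false k p (false ∷ xs) _ = refl
step-heavy⇒first≡false k p (true ∷ xs) heavy with (k ≤ᵇ weight xs) ∧ (weight xs ≤ᵇ k + p) in inRange
... | true = contradiction (subst (_≤ k + p) xs-heavy xs≤k+p) 1+n≰n
  where
  xs-heavy : weight xs ≡ suc (k + p)
  xs-heavy = trans (sym (+-identityʳ _)) (trans (sym (weight-∷ʳ xs false)) heavy)
  xs≤k+p : weight xs ≤ k + p
  xs≤k+p = ≤ᵇ⇒≤ _ _ (proj₂ (Equivalence.to T-∧ (subst T (sym inRange) tt)))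
... | false = ⊥-elim (subst T inRange (Equivalence.from T-∧ (≤⇒≤ᵇ k≤w , ≤⇒≤ᵇ (≤-reflexive xs≡k+p))))
  where
  xs≡k+p : weight xs ≡ k + p
  xs≡k+p = suc-injective (trans (+-comm 1 _) (trans (sym (weight-∷ʳ xs true)) heavy))
  k≤w : k ≤ weight xs
  k≤w = subst (k ≤_) (sym xs≡k+p) (m≤m+n k p)

-- Positions out of range read as false.
lookupℕ : ∀ {n} → Vec Bool n → ℕ → Bool
lookupℕ [] _ = false
lookupℕ (x ∷ xs) zero = x
lookupℕ (x ∷ xs) (suc m) = lookupℕ xs m

lookupℕ-ext : ∀ {n} (v w : Vec Bool n) → (∀ m → m < n → lookupℕ v m ≡ lookupℕ w m) → v ≡ w
lookupℕ-ext [] [] _ = refl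
lookupℕ-ext (x ∷ v) (y ∷ w) eq = cong₂ _∷_ (eq zero (s≤s z≤n)) (lookupℕ-ext v w λ m m<n → eq (suc m) (s≤s m<n))

lookupℕ-zero : ∀ {n} (w : Vec Bool n) → lookupℕ w 0 ≡ first w
lookupℕ-zero [] = refl
lookupℕ-zero (x ∷ w) = refl

lookupℕ-∷ʳ : ∀ {n} (xs : Vec Bool n) y {m} → m < n → lookupℕ (xs ∷ʳ y) m ≡ lookupℕ xs m
lookupℕ-∷ʳ (x ∷ xs) y {zero} _ = refl
lookupℕ-∷ʳ (x ∷ xs) y {suc m} (s≤s m<n) = lookupℕ-∷ʳ xs y m<n

lookupℕ-step : ∀ k p {n} (w : Vec Bool n) {m} → suc m < n → lookupℕ (step k p w) m ≡ lookupℕ w (suc m)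
lookupℕ-step k p (x ∷ xs) (s≤s m+1<n) = lookupℕ-∷ʳ xs _ m+1<n

lookupℕ-window : ∀ k p {n} (A : Vec Bool n) i {m} → m < n → lookupℕ (window k p A i) m ≡ seqA k p A (i + m)
lookupℕ-window k p A i {zero} _ =
  trans (lookupℕ-zero (window k p A i)) (cong (seqA k p A) (sym (+-identityʳ i)))
lookupℕ-window k p A i {suc m} m+1<n = begin
  lookupℕ (window k p A i) (suc m)          ≡⟨ lookupℕ-step k p (window k p A i) m+1<n ⟨
  lookupℕ (window k p A (suc i)) m          ≡⟨ lookupℕ-window k p A (suc i) (<-trans (n<1+n m) m+1<n) ⟩
  seqA k p A (suc i + m)                    ≡⟨ cong (seqA k p A) (+-suc i m) ⟨
  seqA k p A (i + suc m)                    ∎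
  where open ≡-Reasoning

window-period : ∀ k p {n} (A : Vec Bool n) {r} → IsPeriod (seqA k p A) r → window k p A r ≡ A
window-period k p A {r} (_ , shift) = lookupℕ-ext (window k p A r) A λ m m<n → begin
  lookupℕ (window k p A r) m   ≡⟨ lookupℕ-window k p A r m<n ⟩
  seqA k p A (r + m)           ≡⟨ shift m ⟩
  seqA k p A m                 ≡⟨ lookupℕ-window k p A 0 m<n ⟨
  lookupℕ A m                  ∎
  where open ≡-Reasoning

period-preceded-by-0 : ∀ k p {n} (A : Vec Bool n) → weight A ≡ suc (k + p) →
  ∀ m → IsPeriod (seqA k p A) (suc m) → seqA k p A m ≡ false
period-preceded-by-0 k p {zero} [] () _ _
period-preceded-by-0 k p {suc n} A heavy m per =
  step-heavy⇒first≡false k p (window k p A m) (trans (cong weight (window-period k p A per)) heavy)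

proposition45p4 : (k p n : ℕ) → k + p < n → (A : Vec Bool n) →
    first A ≡ true → weight A ≡ suc (k + p) →
    (q : ℕ → ℕ) → IsRunVector (seqA k p A) q →
    (j : ℕ) → IsLeastEvenVectorPeriod q j →
    IsMinimalPeriod (seqA k p A) (psum q j)
proposition45p4 k p n _ A a₁≡1 heavy q runs j least =
  leastEvenVectorPeriod⇒minimalPeriod runs a₁≡1 (period-preceded-by-0 k p A heavy) least
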